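{- Let $2 \leq \ell \leq k \leq \frac{q^n-1}{q-1}$ with $\ell \leq n$. Then $\operatorname{Ind}_q^{\operatorname{pro}}(n,k,\ell)=\frac{q^n-1}{q-1}$ if and only if $k> \frac{q^{\ell-1}-1}{q-1}$. Equivalently, $\mathbb{P}^{n-1}(\mathbb{F}_q)$ is $(k,\ell)$-pro-independent if and only if $k> \frac{q^{\ell-1}-1}{q-1}$.
   Context: For $1\le\ell\le k\le\frac{q^n-1}{q-1}$ with $\ell\le n$, a set $S\subseteq\mathbb{P}^{n-1}(\mathbb{F}_q)$ is $(k,\ell)$-pro-independent if every $X\subseteq S$ of size $k$ contains $\ell$ linearly independent points (i.e. lifts of $X$ to $\mathbb{F}_q^n$ span a subspace of dimension $\ge\ell$); $\operatorname{Ind}^{\rm pro}_q(n,k,\ell)$ is the maximum size of a $(k,\ell)$-pro-independent subset of $\mathbb{P}^{n-1}(\mathbb{F}_q)$. -}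

module Defs where

open import Level using (Level; _⊔_) renaming (suc to lsuc)
open import Data.Nat using (ℕ; zero; suc; _^_; _≤_; _<_) renaming (_+_ to _+ℕ_)
open import Data.Fin using (Fin; zero; suc)
open import Data.Product using (Σ; ∃; _×_; _,_)
open import Relation.Nullary using (¬_)
open import Relation.Binary.PropositionalEquality using (_≡_)
open import Function.Definitions using (Injective)
open import Algebra.Bundles using (CommutativeRing)

record FiniteField (c ℓ : Level) (q : ℕ) : Set (lsuc (c ⊔ ℓ)) where
  field
    commRing : CommutativeRing c ℓ
  open CommutativeRing commRing public
    using (Carrier; _≈_; _+_; _*_; 0#; 1#)
  field
    0≉1       : ¬ (0# ≈ 1#)
    inverse   : ∀ x → ¬ (x ≈ 0#) → ∃ λ y → (x * y) ≈ 1#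
    enum      : Fin q → Carrier
    enum-inj  : ∀ i j → enum i ≈ enum j → i ≡ j
    enum-surj : ∀ x → ∃ λ i → enum i ≈ x

-- geometric sum  θ q m = 1 + q + ... + q^(m-1) = (q^m - 1)/(q - 1)
θ : ℕ → ℕ → ℕ
θ q zero    = 0
θ q (suc m) = q ^ m +ℕ θ q m

module _ {c ℓ : Level} {q : ℕ} (F : FiniteField c ℓ q) where
  open FiniteField F using (Carrier; _≈_; _+_; _*_; 0#)

  Vector : ℕ → Set c
  Vector n = Fin n → Carrier

  _≈ᵥ_ : {n : ℕ} → Vector n → Vector n → Set ℓ
  u ≈ᵥ v = ∀ j → u j ≈ v j

  0ᵥ : {n : ℕ} → Vector n
  0ᵥ j = 0#

  linComb : {n m : ℕ} → (Fin m → Carrier) → (Fin m → Vector n) → Vector n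
  linComb {m = zero}  a v j = 0#
  linComb {m = suc m} a v j = (a zero * v zero j) + linComb (λ i → a (suc i)) (λ i → v (suc i)) j

  LinearlyIndependent : {n m : ℕ} → (Fin m → Vector n) → Set (c ⊔ ℓ)
  LinearlyIndependent v = ∀ a → linComb a v ≈ᵥ 0ᵥ → ∀ i → a i ≈ 0#

  -- A point of P^{n-1}(F_q) is represented by a nonzero vector (a lift);
  -- two lifts represent the same point iff they are proportional.
  NonZeroVec : {n : ℕ} → Vector n → Set ℓ
  NonZeroVec v = ¬ (v ≈ᵥ 0ᵥ)

  SamePoint : {n : ℕ} → Vector n → Vector n → Set (c ⊔ ℓ)
  SamePoint u v = ∃ λ a → u ≈ᵥ (λ j → a * v j)

  -- A subset S ⊆ P^{n-1}(F_q) of size m: m lifts of pairwise distinct points.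
  record ProjSubset (n m : ℕ) : Set (c ⊔ ℓ) where
    field
      pt       : Fin m → Vector n
      nonzero  : ∀ i → NonZeroVec (pt i)
      distinct : ∀ i j → SamePoint (pt i) (pt j) → i ≡ j

  ProIndependent : {n m : ℕ} → ℕ → ℕ → ProjSubset n m → Set (c ⊔ ℓ)
  ProIndependent {m = m} k l S =
    (X : Fin k → Fin m) → Injective _≡_ _≡_ X →
    ∃ λ (Y : Fin l → Fin k) → Injective _≡_ _≡_ Y ×
      LinearlyIndependent (λ i → ProjSubset.pt S (X (Y i)))

  IndPro≡ : ℕ → ℕ → ℕ → ℕ → Set (c ⊔ ℓ)
  IndPro≡ n k l N =
    (Σ (ProjSubset n N) λ S → ProIndependent k l S) ×
    (∀ m (S : ProjSubset n m) → ProIndependent k l S → m ≤ N)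

{-# OPTIONS --safe #-}
-- Write ℓ = m + 1.  If k > θ(m), choose independent points greedily among any k
-- distinct points: while j ≤ m points are chosen, not all k points can lie in their
-- span, because the coefficient vectors would be k distinct points of P^{j-1}, which
-- has only θ(j) ≤ θ(m) < k points.  If k ≤ θ(m), the whole space contains k points of
-- the coordinate subspace F^m, and no m + 1 of them are independent: a ↦ Σ aᵢ vᵢ
-- would inject F^{m+1} into F^m.  Finally, normalising the first nonzero coordinate
-- to 1 injects every set of points into Fin θ(n), so the whole space is maximal.
module Submission where

open import Defs
open import Level using (Level; _⊔_)
open import Data.Nat as ℕ using (ℕ; zero; suc; _≤_; _<_; _∸_; _^_)
import Data.Nat.Properties as ℕP
open import Data.Fin
  using (Fin; zero; suc; _↑ˡ_; _↑ʳ_; splitAt; join; combine; inject≤; punchOut; funToFin; finToFun)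
import Data.Fin.Properties as FinP
open import Data.Vec.Functional using ([]; _∷_; head; tail)
open import Data.Product using (∃; _×_; _,_; proj₁; proj₂)
open import Data.Sum using (_⊎_; inj₁; inj₂)
open import Data.Empty using (⊥-elim)
open import Function using (_∘_)
open import Function.Bundles using (_⇔_; mk⇔)
open import Function.Definitions using (Injective; StrictlySurjective)
open import Relation.Nullary using (¬_; Dec; yes; no)
open import Relation.Nullary.Decidable using (map′; decidable-stable)
open import Relation.Binary.PropositionalEquality as ≡ using (_≡_; _≢_; _≗_)
open import Algebra.Bundles using (CommutativeRing)

private
  variable
    a : Level
    A : Set a
    j k m n M : ℕ

funToFin-cong : {f g : Fin m → Fin n} → f ≗ g → funToFin f ≡ funToFin g
funToFin-cong {m = zero}  f≗g = ≡.refl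
funToFin-cong {m = suc m} f≗g = ≡.cong₂ combine (f≗g zero) (funToFin-cong (f≗g ∘ suc))

splitAt-injective : ∀ m {i j : Fin (m ℕ.+ n)} → splitAt m i ≡ splitAt m j → i ≡ j
splitAt-injective {n} m {i} {j} eq = ≡.trans (≡.sym (FinP.join-splitAt m n i))
  (≡.trans (≡.cong (join m n) eq) (FinP.join-splitAt m n j))

↑ˡ≢↑ʳ : (i : Fin m) (j : Fin n) → i ↑ˡ n ≢ m ↑ʳ j
↑ˡ≢↑ʳ {m} {n} i j eq with () ← ≡.trans (≡.sym (FinP.splitAt-↑ˡ m i n))
  (≡.trans (≡.cong (splitAt m) eq) (FinP.splitAt-↑ʳ m n j))

injective⇒strictlySurjective : (f : Fin n → Fin n) → Injective _≡_ _≡_ f →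
                               StrictlySurjective _≡_ f
injective⇒strictlySurjective {n} f f-inj y with FinP.any? (λ i → f i FinP.≟ y)
... | yes found = found
injective⇒strictlySurjective {suc n} f f-inj y | no missed =
  ⊥-elim (ℕP.1+n≰n (FinP.injective⇒≤ {f = f′} (f-inj ∘ FinP.punchOut-injective (y≢f _) (y≢f _))))
  where
  y≢f : ∀ i → y ≢ f i
  y≢f i y≡fi = missed (i , ≡.sym y≡fi)
  f′ : Fin (suc n) → Fin n
  f′ i = punchOut (y≢f i)

∷-injective : {x : A} {f : Fin n → A} → (∀ s → f s ≢ x) → Injective _≡_ _≡_ f →
              Injective _≡_ _≡_ (x ∷ f)
∷-injective x∉f f-inj {zero}  {zero}  _  = ≡.refl
∷-injective x∉f f-inj {zero}  {suc t} eq = ⊥-elim (x∉f t (≡.sym eq))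
∷-injective x∉f f-inj {suc s} {zero}  eq = ⊥-elim (x∉f s eq)
∷-injective x∉f f-inj {suc s} {suc t} eq = ≡.cong suc (f-inj eq)

module _ {c ℓ : Level} {q : ℕ} (F : FiniteField c ℓ q) where
  open FiniteField F using (commRing; 0≉1; inverse; enum; enum-inj; enum-surj)
  open CommutativeRing commRing hiding (zero)
  open import Relation.Binary.Reasoning.Setoid setoid
  open import Algebra.Properties.Ring ring using (-‿distribˡ-*; -‿distribʳ-*; [y-z]x≈yx-zx)
  open import Algebra.Properties.AbelianGroup +-abelianGroup
    using (inverseˡ-unique; x∙y⁻¹≈ε⇒x≈y; x≈y⇒x∙y⁻¹≈ε; ⁻¹-∙-comm)
  open import Algebra.Properties.CommutativeSemigroup +-commutativeSemigroup using (interchange)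

  private
    Vec : ℕ → Set c
    Vec = Vector F

    _≋_ : Vec n → Vec n → Set ℓ
    _≋_ = _≈ᵥ_ F

  open ProjSubset

  index : Carrier → Fin q
  index x = proj₁ (enum-surj x)

  enum-index : ∀ x → enum (index x) ≈ x
  enum-index x = proj₂ (enum-surj x)

  index-injective : ∀ {x y} → index x ≡ index y → x ≈ y
  index-injective {x} {y} eq =
    trans (sym (enum-index x)) (trans (reflexive (≡.cong enum eq)) (enum-index y))

  index-cong : ∀ {x y} → x ≈ y → index x ≡ index y
  index-cong {x} {y} x≈y = enum-inj _ _ (trans (enum-index x) (trans x≈y (sym (enum-index y))))

  _≈?_ : ∀ x y → Dec (x ≈ y)
  x ≈? y = map′ index-injective index-cong (index x FinP.≟ index y)

  _≋?_ : (u v : Vec n) → Dec (u ≋ v)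
  u ≋? v = FinP.all? (λ r → u r ≈? v r)

  1<q : 1 < q
  1<q = FinP.injective⇒≤ {f = index 0# ∷ index 1# ∷ []} injective
    where
    injective : Injective _≡_ _≡_ (index 0# ∷ index 1# ∷ [])
    injective {zero}     {zero}     _  = ≡.refl
    injective {zero}     {suc zero} eq = ⊥-elim (0≉1 (index-injective eq))
    injective {suc zero} {zero}     eq = ⊥-elim (0≉1 (sym (index-injective eq)))
    injective {suc zero} {suc zero} _  = ≡.refl

  inv : ∀ x → ¬ x ≈ 0# → Carrier
  inv x x≉0 = proj₁ (inverse x x≉0)

  *-inverseʳ : ∀ x (x≉0 : ¬ x ≈ 0#) → x * inv x x≉0 ≈ 1#
  *-inverseʳ x x≉0 = proj₂ (inverse x x≉0)

  *-inverseˡ : ∀ x (x≉0 : ¬ x ≈ 0#) → inv x x≉0 * x ≈ 1#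
  *-inverseˡ x x≉0 = trans (*-comm _ _) (*-inverseʳ x x≉0)

  x*y+z≈0⇒y≈-x⁻¹*z : ∀ {x} (x≉0 : ¬ x ≈ 0#) y z → x * y + z ≈ 0# → y ≈ - inv x x≉0 * z
  x*y+z≈0⇒y≈-x⁻¹*z {x} x≉0 y z eq = begin
    y                     ≈⟨ sym (*-identityˡ y) ⟩
    1# * y                ≈⟨ *-congʳ (sym (*-inverseˡ x x≉0)) ⟩
    inv x x≉0 * x * y     ≈⟨ *-assoc _ _ _ ⟩
    inv x x≉0 * (x * y)   ≈⟨ *-congˡ (inverseˡ-unique _ _ eq) ⟩
    inv x x≉0 * - z       ≈⟨ sym (-‿distribʳ-* _ _) ⟩
    - (inv x x≉0 * z)     ≈⟨ -‿distribˡ-* _ _ ⟩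
    - inv x x≉0 * z       ∎

  encode : Vec n → Fin (q ^ n)
  encode v = funToFin (index ∘ v)

  decode : Fin (q ^ n) → Vec n
  decode s = enum ∘ finToFun s

  decode-encode : (v : Vec n) → decode (encode v) ≋ v
  decode-encode v r =
    trans (reflexive (≡.cong enum (FinP.finToFun-funToFin (index ∘ v) r))) (enum-index (v r))

  encode-injective : {u v : Vec n} → encode u ≡ encode v → u ≋ v
  encode-injective {u = u} {v} eq r =
    trans (sym (decode-encode u r)) (trans (reflexive (≡.cong (λ s → decode s r) eq)) (decode-encode v r))

  decode-injective : {s t : Fin (q ^ n)} → decode {n} s ≋ decode t → s ≡ t
  decode-injective {n} {s} {t} eq = ≡.trans (≡.sym (FinP.funToFin-finToFin {n} s))
    (≡.trans (funToFin-cong {g = finToFun t} (λ r → enum-inj _ _ (eq r))) (FinP.funToFin-finToFin {n} t))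

  injection⇒dim≤ : (f : Vec m → Vec n) → (∀ {a b} → f a ≋ f b → a ≋ b) → m ≤ n
  injection⇒dim≤ f f-inj = ℕP.≮⇒≥ λ n<m →
    ℕP.<⇒≱ (ℕP.^-monoʳ-< q 1<q n<m)
      (FinP.injective⇒≤ {f = encode ∘ f ∘ decode} (decode-injective ∘ f-inj ∘ encode-injective))

  linComb-cong : (V : Fin m → Vec n) {a b : Fin m → Carrier} → (∀ t → a t ≈ b t) →
                 linComb F a V ≋ linComb F b V
  linComb-cong {zero}  V a≈b r = refl
  linComb-cong {suc m} V a≈b r = +-cong (*-congʳ (a≈b zero)) (linComb-cong (tail V) (a≈b ∘ suc) r)

  linComb-scale : ∀ x (a : Fin m → Carrier) (V : Fin m → Vec n) r →
                  linComb F (λ t → x * a t) V r ≈ x * linComb F a V r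
  linComb-scale {zero}  x a V r = sym (zeroʳ x)
  linComb-scale {suc m} x a V r = begin
    x * a zero * V zero r + linComb F (λ t → x * a (suc t)) (tail V) r
      ≈⟨ +-cong (*-assoc _ _ _) (linComb-scale x (tail a) (tail V) r) ⟩
    x * (a zero * V zero r) + x * linComb F (tail a) (tail V) r
      ≈⟨ sym (distribˡ _ _ _) ⟩
    x * (a zero * V zero r + linComb F (tail a) (tail V) r) ∎

  linComb-sub : ∀ (a b : Fin m → Carrier) (V : Fin m → Vec n) r →
                linComb F (λ t → a t - b t) V r ≈ linComb F a V r - linComb F b V r
  linComb-sub {zero}  a b V r = sym (-‿inverseʳ 0#)
  linComb-sub {suc m} a b V r = begin
    (a₀ - b₀) * v₀ + linComb F (λ t → a (suc t) - b (suc t)) (tail V) r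
      ≈⟨ +-cong ([y-z]x≈yx-zx _ _ _) (linComb-sub (tail a) (tail b) (tail V) r) ⟩
    (a₀ * v₀ - b₀ * v₀) + (Σa - Σb)  ≈⟨ interchange _ _ _ _ ⟩
    (a₀ * v₀ + Σa) + (- (b₀ * v₀) - Σb)  ≈⟨ +-congˡ (⁻¹-∙-comm _ _) ⟩
    (a₀ * v₀ + Σa) - (b₀ * v₀ + Σb)  ∎
    where
    a₀ = a zero
    b₀ = b zero
    v₀ = V zero r
    Σa = linComb F (tail a) (tail V) r
    Σb = linComb F (tail b) (tail V) r

  linComb-≈0 : ∀ (a : Fin m → Carrier) (V : Fin m → Vec n) r → (∀ t → a t * V t r ≈ 0#) →
               linComb F a V r ≈ 0#
  linComb-≈0 {zero}  a V r terms≈0 = refl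
  linComb-≈0 {suc m} a V r terms≈0 =
    trans (+-cong (terms≈0 zero) (linComb-≈0 (tail a) (tail V) r (terms≈0 ∘ suc))) (+-identityʳ 0#)

  linComb-suc : ∀ (a : Fin m → Carrier) (V : Fin m → Vec (suc n)) r →
                linComb F a V (suc r) ≡ linComb F a (tail ∘ V) r
  linComb-suc {zero}  a V r = ≡.refl
  linComb-suc {suc m} a V r = ≡.cong (a zero * V zero (suc r) +_) (linComb-suc (tail a) (tail V) r)

  linComb-injective : {V : Fin m → Vec n} → LinearlyIndependent F V →
                      ∀ {a b} → linComb F a V ≋ linComb F b V → ∀ t → a t ≈ b t
  linComb-injective {V = V} V-ind {a} {b} eq t = x∙y⁻¹≈ε⇒x≈y (a t) (b t)
    (V-ind (λ t → a t - b t) (λ r → trans (linComb-sub a b V r) (x≈y⇒x∙y⁻¹≈ε (eq r))) t)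

  independent⇒≤ : {V : Fin m → Vec n} → LinearlyIndependent F V → m ≤ n
  independent⇒≤ {V = V} V-ind = injection⇒dim≤ (λ a → linComb F a V) (linComb-injective V-ind)

  InSpan : Vec n → (Fin m → Vec n) → Set (c ⊔ ℓ)
  InSpan w V = ∃ λ a → w ≋ linComb F a V

  inSpan? : (w : Vec n) (V : Fin m → Vec n) → Dec (InSpan w V)
  inSpan? {m = m} w V = map′
    (λ (s , w≋) → decode s , w≋)
    (λ (a , w≋) → encode a , λ r → trans (w≋ r) (linComb-cong V (λ t → sym (decode-encode a t)) r))
    (FinP.any? (λ s → w ≋? linComb F (decode {m} s) V))

  member-inSpan : (V : Fin m → Vec n) (t : Fin m) → InSpan (V t) V
  member-inSpan V zero = (1# ∷ λ _ → 0#) , λ r →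
    sym (trans (+-cong (*-identityˡ _) (linComb-≈0 _ (tail V) r (λ t → zeroˡ _))) (+-identityʳ _))
  member-inSpan V (suc t) with a , Vt≋ ← member-inSpan (tail V) t =
    (0# ∷ a) , λ r → trans (Vt≋ r) (sym (trans (+-congʳ (zeroˡ _)) (+-identityˡ _)))

  ∷-independent : {w : Vec n} {V : Fin m → Vec n} → LinearlyIndependent F V → ¬ InSpan w V →
                  LinearlyIndependent F (w ∷ V)
  ∷-independent {w = w} {V} V-ind w∉V a combination≈0 = coefficients≈0
    where
    a₀≈0 : a zero ≈ 0#
    a₀≈0 = decidable-stable (a zero ≈? 0#) λ a₀≉0 → w∉V (_ , λ r →
      trans (x*y+z≈0⇒y≈-x⁻¹*z a₀≉0 _ _ (combination≈0 r)) (sym (linComb-scale _ (tail a) V r)))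
    rest≈0 : linComb F (tail a) V ≋ 0ᵥ F
    rest≈0 r = begin
      linComb F (tail a) V r                   ≈⟨ sym (+-identityˡ _) ⟩
      0# + linComb F (tail a) V r              ≈⟨ +-congʳ (sym (trans (*-congʳ a₀≈0) (zeroˡ _))) ⟩
      a zero * w r + linComb F (tail a) V r    ≈⟨ combination≈0 r ⟩
      0#                                       ∎
    coefficients≈0 : ∀ t → a t ≈ 0#
    coefficients≈0 zero    = a₀≈0
    coefficients≈0 (suc t) = V-ind (tail a) rest≈0 t

  tail-independent : (V : Fin m → Vec (suc n)) → (∀ s → head (V s) ≈ 0#) →
                     LinearlyIndependent F V → LinearlyIndependent F (tail ∘ V)
  tail-independent V heads≈0 V-ind a tails≈0 = V-ind a combination≈0
    where
    combination≈0 : linComb F a V ≋ 0ᵥ F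
    combination≈0 zero    = linComb-≈0 a V zero (λ t → trans (*-congˡ (heads≈0 t)) (zeroʳ _))
    combination≈0 (suc r) = trans (reflexive (linComb-suc a V r)) (tails≈0 r)

  tail-nonZero : {v : Vec (suc n)} → NonZeroVec F v → head v ≈ 0# → NonZeroVec F (tail v)
  tail-nonZero v≢0 v₀≈0 tail≈0 = v≢0 λ { zero → v₀≈0 ; (suc r) → tail≈0 r }

  normalised-samePoint : (u v : Vec (suc n)) (u₀≉0 : ¬ head u ≈ 0#) (v₀≉0 : ¬ head v ≈ 0#) →
    (∀ r → inv (head u) u₀≉0 * tail u r ≈ inv (head v) v₀≉0 * tail v r) → SamePoint F u v
  normalised-samePoint u v u₀≉0 v₀≉0 eq = u₀ * v₀⁻¹ , proportional
    where
    u₀ = head u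
    v₀ = head v
    u₀⁻¹ = inv u₀ u₀≉0
    v₀⁻¹ = inv v₀ v₀≉0
    proportional : ∀ r → u r ≈ u₀ * v₀⁻¹ * v r
    proportional zero = begin
      u₀                 ≈⟨ sym (*-identityʳ u₀) ⟩
      u₀ * 1#            ≈⟨ *-congˡ (sym (*-inverseˡ v₀ v₀≉0)) ⟩
      u₀ * (v₀⁻¹ * v₀)   ≈⟨ sym (*-assoc _ _ _) ⟩
      u₀ * v₀⁻¹ * v₀     ∎
    proportional (suc r) = begin
      u (suc r)                ≈⟨ sym (*-identityˡ _) ⟩
      1# * u (suc r)           ≈⟨ *-congʳ (sym (*-inverseʳ u₀ u₀≉0)) ⟩
      u₀ * u₀⁻¹ * u (suc r)    ≈⟨ *-assoc _ _ _ ⟩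
      u₀ * (u₀⁻¹ * u (suc r))  ≈⟨ *-congˡ (eq r) ⟩
      u₀ * (v₀⁻¹ * v (suc r))  ≈⟨ sym (*-assoc _ _ _) ⟩
      u₀ * v₀⁻¹ * v (suc r)    ∎

  pointCode : (v : Vec n) → NonZeroVec F v → Fin (θ q n)
  pointCode {zero}  v v≢0 = ⊥-elim (v≢0 λ ())
  pointCode {suc n} v v≢0 with head v ≈? 0#
  ... | yes v₀≈0 = q ^ n ↑ʳ pointCode (tail v) (tail-nonZero v≢0 v₀≈0)
  ... | no  v₀≉0 = encode (λ r → inv (head v) v₀≉0 * tail v r) ↑ˡ θ q n

  pointCode-injective : (u v : Vec n) (u≢0 : NonZeroVec F u) (v≢0 : NonZeroVec F v) →
                        pointCode u u≢0 ≡ pointCode v v≢0 → SamePoint F u v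
  pointCode-injective {zero} u v u≢0 v≢0 eq = ⊥-elim (u≢0 λ ())
  pointCode-injective {suc n} u v u≢0 v≢0 eq with head u ≈? 0# | head v ≈? 0#
  ... | yes u₀≈0 | yes v₀≈0
    with x , tails∼ ← pointCode-injective (tail u) (tail v) _ _ (FinP.↑ʳ-injective (q ^ n) _ _ eq)
    = x , λ { zero → trans u₀≈0 (sym (trans (*-congˡ v₀≈0) (zeroʳ x))) ; (suc r) → tails∼ r }
  ... | yes _    | no  _    = ⊥-elim (↑ˡ≢↑ʳ _ _ (≡.sym eq))
  ... | no  _    | yes _    = ⊥-elim (↑ˡ≢↑ʳ _ _ eq)
  ... | no  u₀≉0 | no  v₀≉0 =
    normalised-samePoint u v u₀≉0 v₀≉0 (encode-injective (FinP.↑ˡ-injective (θ q n) _ _ eq))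

  pointCodes : ProjSubset F n m → Fin m → Fin (θ q n)
  pointCodes S i = pointCode (pt S i) (nonzero S i)

  pointCodes-injective : (S : ProjSubset F n m) → Injective _≡_ _≡_ (pointCodes S)
  pointCodes-injective S eq = distinct S _ _ (pointCode-injective _ _ _ _ eq)

  size≤θ : ProjSubset F n m → m ≤ θ q n
  size≤θ S = FinP.injective⇒≤ (pointCodes-injective S)

  mutual
    standardPoint : ∀ n → Fin (θ q n) → Vec n
    standardPoint (suc n) i = standardPoint⊎ {n} (splitAt (q ^ n) i)

    standardPoint⊎ : Fin (q ^ n) ⊎ Fin (θ q n) → Vec (suc n)
    standardPoint⊎ (inj₁ a) = 1# ∷ decode a
    standardPoint⊎ (inj₂ b) = 0# ∷ standardPoint _ b

  standardPoint-nonZero : ∀ n i → NonZeroVec F (standardPoint n i)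
  standardPoint-nonZero (suc n) i with splitAt (q ^ n) i
  ... | inj₁ a = λ p≈0 → 0≉1 (sym (p≈0 zero))
  ... | inj₂ b = λ p≈0 → standardPoint-nonZero n b (p≈0 ∘ suc)

  mutual
    standardPoint-distinct : ∀ n i j → SamePoint F (standardPoint n i) (standardPoint n j) → i ≡ j
    standardPoint-distinct (suc n) i j p∼p′ =
      splitAt-injective (q ^ n)
        (standardPoint⊎-distinct {n} (splitAt (q ^ n) i) (splitAt (q ^ n) j) p∼p′)

    standardPoint⊎-distinct : (s t : Fin (q ^ n) ⊎ Fin (θ q n)) →
                              SamePoint F (standardPoint⊎ s) (standardPoint⊎ t) → s ≡ t
    standardPoint⊎-distinct (inj₁ a) (inj₁ b) (x , h) = ≡.cong inj₁ (decode-injective λ r → begin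
      decode a r       ≈⟨ h (suc r) ⟩
      x * decode b r   ≈⟨ *-congʳ (trans (sym (*-identityʳ x)) (sym (h zero))) ⟩
      1# * decode b r  ≈⟨ *-identityˡ _ ⟩
      decode b r       ∎)
    standardPoint⊎-distinct (inj₁ a) (inj₂ b) (x , h) = ⊥-elim (0≉1 (sym (trans (h zero) (zeroʳ x))))
    standardPoint⊎-distinct {n} (inj₂ a) (inj₁ b) (x , h) =
      ⊥-elim (standardPoint-nonZero n a λ r → trans (h (suc r)) (trans (*-congʳ x≈0) (zeroˡ _)))
      where
      x≈0 : x ≈ 0#
      x≈0 = trans (sym (*-identityʳ x)) (sym (h zero))
    standardPoint⊎-distinct {n} (inj₂ a) (inj₂ b) (x , h) =
      ≡.cong inj₂ (standardPoint-distinct n a b (x , h ∘ suc))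

  allPoints : ∀ n → ProjSubset F n (θ q n)
  allPoints n = record
    { pt = standardPoint n ; nonzero = standardPoint-nonZero n ; distinct = standardPoint-distinct n }

  subfamily : (S : ProjSubset F n M) (X : Fin k → Fin M) → Injective _≡_ _≡_ X → ProjSubset F n k
  subfamily S X X-inj = record
    { pt = pt S ∘ X ; nonzero = nonzero S ∘ X ; distinct = λ i j i∼j → X-inj (distinct S _ _ i∼j) }

  padZeros : ∀ d → Vec m → Vec (d ℕ.+ m)
  padZeros zero    v = v
  padZeros (suc d) v = 0# ∷ padZeros d v

  padZeros-nonZero : ∀ d {v : Vec m} → NonZeroVec F v → NonZeroVec F (padZeros d v)
  padZeros-nonZero zero    v≢0 = v≢0
  padZeros-nonZero (suc d) v≢0 p≈0 = padZeros-nonZero d v≢0 (p≈0 ∘ suc)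

  padZeros-samePoint⁻¹ : ∀ d {u v : Vec m} → SamePoint F (padZeros d u) (padZeros d v) → SamePoint F u v
  padZeros-samePoint⁻¹ zero    u∼v       = u∼v
  padZeros-samePoint⁻¹ (suc d) (x , u∼v) = padZeros-samePoint⁻¹ d (x , u∼v ∘ suc)

  padSubset : ∀ d → ProjSubset F m k → ProjSubset F (d ℕ.+ m) k
  padSubset d T = record
    { pt       = padZeros d ∘ pt T
    ; nonzero  = padZeros-nonZero d ∘ nonzero T
    ; distinct = λ i j i∼j → distinct T i j (padZeros-samePoint⁻¹ d i∼j)
    }

  independent-padded⇒≤ : ∀ d (V : Fin j → Vec (d ℕ.+ m)) →
    (∀ s → ∃ λ (v : Vec m) → SamePoint F (V s) (padZeros d v)) → LinearlyIndependent F V → j ≤ m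
  independent-padded⇒≤ zero    V padded V-ind = independent⇒≤ V-ind
  independent-padded⇒≤ (suc d) V padded V-ind =
    independent-padded⇒≤ d (tail ∘ V) tails-padded (tail-independent V heads≈0 V-ind)
    where
    heads≈0 : ∀ s → head (V s) ≈ 0#
    heads≈0 s with _ , x , Vs∼ ← padded s = trans (Vs∼ zero) (zeroʳ x)
    tails-padded : ∀ s → ∃ λ v → SamePoint F (tail (V s)) (padZeros d v)
    tails-padded s with v , x , Vs∼ ← padded s = v , x , Vs∼ ∘ suc

  fullSubset-embeds : (S : ProjSubset F n (θ q n)) (T : ProjSubset F n k) →
    ∃ λ (X : Fin k → Fin (θ q n)) → Injective _≡_ _≡_ X × (∀ r → SamePoint F (pt S (X r)) (pt T r))
  fullSubset-embeds S T = X , X-injective , λ r → pointCode-injective _ _ _ _ (code-X r)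
    where
    onto = injective⇒strictlySurjective (pointCodes S) (pointCodes-injective S)
    X : Fin _ → Fin _
    X r = proj₁ (onto (pointCodes T r))
    code-X : ∀ r → pointCodes S (X r) ≡ pointCodes T r
    code-X r = proj₂ (onto (pointCodes T r))
    X-injective : Injective _≡_ _≡_ X
    X-injective {r} {r′} eq =
      pointCodes-injective T
        (≡.trans (≡.sym (code-X r)) (≡.trans (≡.cong (pointCodes S) eq) (code-X r′)))

  span-size≤θ : (T : ProjSubset F n k) (V : Fin j → Vec n) → (∀ i → InSpan (pt T i) V) → k ≤ θ q j
  span-size≤θ {j = j} T V spans = size≤θ coefficientPoints
    where
    coefficients : ∀ i → Vec j
    coefficients i = proj₁ (spans i)
    expansion : ∀ i → pt T i ≋ linComb F (coefficients i) V
    expansion i = proj₂ (spans i)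
    coefficientPoints : ProjSubset F j _
    coefficientPoints = record
      { pt       = coefficients
      ; nonzero  = λ i c≈0 → nonzero T i λ r →
          trans (expansion i r) (linComb-≈0 _ V r λ t → trans (*-congʳ (c≈0 t)) (zeroˡ _))
      ; distinct = λ i i′ (x , c∼c′) → distinct T i i′ (x , λ r → begin
          pt T i r                                 ≈⟨ expansion i r ⟩
          linComb F (coefficients i) V r           ≈⟨ linComb-cong V c∼c′ r ⟩
          linComb F (λ t → x * coefficients i′ t) V r ≈⟨ linComb-scale x (coefficients i′) V r ⟩
          x * linComb F (coefficients i′) V r      ≈⟨ *-congˡ (sym (expansion i′ r)) ⟩
          x * pt T i′ r                            ∎)
      }

  IndependentSelection : ProjSubset F n k → ℕ → Set (c ⊔ ℓ)
  IndependentSelection {k = k} T j =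
    ∃ λ (Y : Fin j → Fin k) → Injective _≡_ _≡_ Y × LinearlyIndependent F (pt T ∘ Y)

  extendSelection : (T : ProjSubset F n k) → θ q j < k →
                    IndependentSelection T j → IndependentSelection T (suc j)
  extendSelection {k = k} T θj<k (Y , Y-inj , Y-ind)
    with FinP.all? (λ i → inSpan? (pt T i) (pt T ∘ Y))
  ... | yes allInSpan = ⊥-elim (ℕP.<⇒≱ θj<k (span-size≤θ T (pt T ∘ Y) allInSpan))
  ... | no notAll
    with i , i∉ ← FinP.¬∀⟶∃¬ k _ (λ i → inSpan? (pt T i) (pt T ∘ Y)) notAll =
    (i ∷ Y) , ∷-injective Y≢i Y-inj , ∷-independent Y-ind i∉
    where
    Y≢i : ∀ s → Y s ≢ i
    Y≢i s Ys≡i = i∉ (≡.subst (λ z → InSpan (pt T z) (pt T ∘ Y)) Ys≡i (member-inSpan (pt T ∘ Y) s))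

  independentSelection : (T : ProjSubset F n k) → ∀ j → θ q j < k → IndependentSelection T (suc j)
  independentSelection T zero    θ0<k = extendSelection T θ0<k ((λ ()) , (λ { {()} }) , λ _ _ ())
  independentSelection T (suc j) θj+1<k = extendSelection T θj+1<k
    (independentSelection T j (ℕP.≤-<-trans (ℕP.m≤n+m (θ q j) (q ^ j)) θj+1<k))

  proIndependent : (S : ProjSubset F n M) → θ q m < k → ProIndependent F k (suc m) S
  proIndependent S θm<k X X-inj = independentSelection (subfamily S X X-inj) _ θm<k

  fullSubset-notProIndependent : m ≤ n → k ≤ θ q m → (S : ProjSubset F n (θ q n)) →
                                 ¬ ProIndependent F k (suc m) S
  fullSubset-notProIndependent {m} {n} m≤n with n ∸ m | ℕP.m∸n+n≡m m≤n
  ... | d | ≡.refl = λ k≤θm S pro →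
    let T = padSubset d (subfamily (allPoints m) (λ r → inject≤ r k≤θm)
                                   (FinP.inject≤-injective _ _ _ _))
        X , X-inj , X-samePoint = fullSubset-embeds S T
        Y , _ , Y-ind = pro X X-inj
    in ℕP.1+n≰n (independent-padded⇒≤ d (pt S ∘ X ∘ Y) (λ s → _ , X-samePoint (Y s)) Y-ind)

proposition2p7 : {c ℓ' : Level} (q : ℕ) (F : FiniteField c ℓ' q) (n k ℓ : ℕ) →
    2 ≤ ℓ → ℓ ≤ k → k ≤ θ q n → ℓ ≤ n →
    IndPro≡ F n k ℓ (θ q n) ⇔ (θ q (ℓ ∸ 1) < k)
proposition2p7 q F n k (suc m) _ _ _ ℓ≤n = mk⇔ whole-space⇒θm<k θm<k⇒whole-space
  where
  whole-space⇒θm<k : IndPro≡ F n k (suc m) (θ q n) → θ q m < k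
  whole-space⇒θm<k ((S , pro) , _) =
    ℕP.≰⇒> λ k≤θm → fullSubset-notProIndependent F (ℕP.<⇒≤ ℓ≤n) k≤θm S pro
  θm<k⇒whole-space : θ q m < k → IndPro≡ F n k (suc m) (θ q n)
  θm<k⇒whole-space θm<k =
    (allPoints F n , proIndependent F (allPoints F n) θm<k) , λ _ S _ → size≤θ F S
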